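{- Let $H$ be a split graph that is not a complete split graph, let $G=\overline{H}$ (a split graph), and fix a partition of $V(G)$ into a clique $C(G)$ and an independent set $I(G)$. Let $G_1,G_2$ be two vertex-disjoint copies of $G$, with the induced partitions $V(G_j)=C(G_j)\cup I(G_j)$, $j=1,2$. Let $G'$ be the graph with $V(G')=V(G_1)\cup V(G_2)$ and $E(G')=E(G_1)\cup E(G_2)\cup\{uv: u\in C(G_1),v\in C(G_2)\}\cup\{uv:u\in C(G_1),v\in I(G_2)\}\cup\{uv:u\in C(G_2),v\in I(G_1)\}$. Then $\mathrm{box}(G')\ge t(H)$.
   Context: All graphs are finite, simple and undirected; $\overline{H}$ is the complement of $H$. A split graph is a graph whose vertex set can be partitioned into a clique and an independent set. A complete split graph is a split graph having such a partition into a clique $C$ and independent set $I$ with every vertex of $C$ adjacent to every vertex of $I$. A threshold graph is a graph admitting a real $S$ and vertex weights $w$ with distinct $u,v$ adjacent iff $w(u)+w(v)\ge S$; the threshold dimension $t(H)$ is the least $k$ such that $E(H)$ is the union of the edge sets of $k$ threshold graphs on $V(H)$. The boxicity $\mathrm{box}(G)$ is the minimum $k$ such that $G$ is the intersection graph of $k$-dimensional axis-parallel boxes, equivalently the intersection of $k$ interval graphs on $V(G)$.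
   Formalization: Only interval representations of G′ with rational endpoints enter the boxicity hypothesis, and the threshold weights and threshold S in the conclusion are taken in ℚ rather than the reals. -}

module Defs where

open import Data.Bool using (Bool; true; false; not; _∧_; _∨_; T)
open import Data.Fin using (Fin; _≟_)
open import Data.Nat using (ℕ)
open import Data.Sum using (_⊎_; inj₁; inj₂)
open import Data.Product using (Σ; _×_; ∃; ∃-syntax)
open import Data.Rational using (ℚ; _+_; _≤_)
open import Relation.Binary.PropositionalEquality using (_≡_; _≢_)
open import Relation.Nullary using (¬_; yes; no)
open import Function.Bundles using (_⇔_)

Graph : Set → Set
Graph V = V → V → Bool

IsSimple : {V : Set} → Graph V → Set
IsSimple {V} G = (∀ u v → G u v ≡ G v u) × (∀ v → G v v ≡ false)

complement : {n : ℕ} → Graph (Fin n) → Graph (Fin n)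
complement G u v with u ≟ v
... | yes _ = false
... | no _  = not (G u v)

-- c : V → Bool marks the clique part C (c v ≡ true) ; the rest is I.
IsClique : {V : Set} → Graph V → (V → Bool) → Set
IsClique {V} G c = ∀ (u v : V) → u ≢ v → c u ≡ true → c v ≡ true → G u v ≡ true

IsIndependent : {V : Set} → Graph V → (V → Bool) → Set
IsIndependent {V} G c = ∀ (u v : V) → c u ≡ false → c v ≡ false → G u v ≡ false

IsSplitPartition : {V : Set} → Graph V → (V → Bool) → Set
IsSplitPartition G c = IsClique G c × IsIndependent G c

IsSplit : {V : Set} → Graph V → Set
IsSplit {V} G = Σ (V → Bool) λ c → IsSplitPartition G c

IsCompleteSplit : {V : Set} → Graph V → Set
IsCompleteSplit {V} G = Σ (V → Bool) λ c → IsSplitPartition G c ×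
  (∀ (u v : V) → c u ≡ true → c v ≡ false → G u v ≡ true)

-- The graph G' on two disjoint copies (inj₁ = G₁, inj₂ = G₂) of G,
-- with respect to the clique-marking c.
doubled : {V : Set} → Graph V → (V → Bool) → Graph (V ⊎ V)
doubled G c (inj₁ u) (inj₁ v) = G u v
doubled G c (inj₂ u) (inj₂ v) = G u v
doubled G c (inj₁ u) (inj₂ v) = (c u ∧ c v) ∨ (c u ∧ not (c v)) ∨ (c v ∧ not (c u))
doubled G c (inj₂ u) (inj₁ v) = (c v ∧ c u) ∨ (c v ∧ not (c u)) ∨ (c u ∧ not (c v))

IsThreshold : {V : Set} → Graph V → Set
IsThreshold {V} G = Σ ℚ λ S → Σ (V → ℚ) λ w →
  ∀ (u v : V) → u ≢ v → (G u v ≡ true) ⇔ (S ≤ w u + w v)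

ThresholdCover : {V : Set} → ℕ → Graph V → Set
ThresholdCover {V} k H = Σ (Fin k → Graph V) λ Ts →
  (∀ i → IsSimple (Ts i)) × (∀ i → IsThreshold (Ts i)) ×
  (∀ (u v : V) → u ≢ v → (H u v ≡ true) ⇔ (∃[ i ] Ts i u v ≡ true))

IsInterval : {V : Set} → Graph V → Set
IsInterval {V} G = Σ (V → ℚ) λ l → Σ (V → ℚ) λ r → (∀ v → l v ≤ r v) ×
  (∀ (u v : V) → u ≢ v → (G u v ≡ true) ⇔ (l u ≤ r v × l v ≤ r u))

-- G is the intersection of k interval graphs on V(G)  (i.e. box(G) ≤ k).
BoxRep : {V : Set} → ℕ → Graph V → Set
BoxRep {V} k G = Σ (Fin k → Graph V) λ Is →
  (∀ i → IsSimple (Is i)) × (∀ i → IsInterval (Is i)) ×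
  (∀ (u v : V) → u ≢ v → (G u v ≡ true) ⇔ (∀ i → Is i u v ≡ true))

{-# OPTIONS --safe #-}
module Submission where

open import Defs
open import Data.Bool using (Bool; true; false; not; _∧_; if_then_else_)
open import Data.Bool.Properties using () renaming (_≟_ to _≟ᵇ_)
open import Data.Fin using (Fin; zero; suc; _≟_)
open import Data.Fin.Properties using (any?; ¬∀⟶∃¬)
open import Data.List using (List; []; _∷_; _++_; length; filter; tabulate)
open import Data.List.Membership.Propositional using (_∈_)
open import Data.List.Membership.Propositional.Properties using (∈-tabulate⁺; ∈-++⁺ˡ; ∈-++⁺ʳ; ∈-filter⁺)
open import Data.List.Properties using (length-++; length-tabulate)
open import Data.List.Relation.Unary.Any using (here; there)
open import Data.Nat as ℕ using (ℕ; zero; suc; z≤n; s≤s)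
import Data.Nat.Properties as ℕ
open import Data.Product using (Σ; _×_; _,_; proj₁; proj₂; ∃-syntax)
open import Data.Rational using (ℚ; 0ℚ; 1ℚ; _+_; -_; _≤_; _<_)
open import Data.Rational.Properties
  using (≤-refl; <⇒≤; ≮⇒≥; ≰⇒>; <-irrefl; <-≤-trans; ≤-<-trans; _≤?_; _<?_; positive⁻¹; neg-antimono-<; neg-antimono-≤;
         +-comm; +-assoc; +-identityˡ; +-identityʳ; +-inverseˡ; +-inverseʳ;
         +-mono-≤; +-monoʳ-≤; +-mono-<; +-mono-<-≤; +-mono-≤-<; module ≤-Reasoning)
open import Data.Sum as Sum using (_⊎_; inj₁; inj₂; [_,_])
open import Function using (_∘_; const)
open import Level using (0ℓ)
open import Function.Bundles using (_⇔_; mk⇔; Equivalence)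
import Function.Properties.Equivalence as ⇔
open import Relation.Binary.PropositionalEquality using (_≡_; _≢_; refl; sym; trans; cong; cong₂; subst)
open import Relation.Nullary using (¬_; Dec; yes; no; does; contradiction; _×-dec_)
open import Relation.Unary using (Pred; Decidable)

-- Each of the k interval representations of G′, read in either direction along the line, gives on
-- each copy of V(H) a threshold graph: I(G) forms a clique, and u ∈ C(G) is joined to v ∈ I(G)
-- exactly when the interval of v ends before that of u begins.  Such pairs are nonadjacent in G,
-- so these graphs lie inside H, and over all 2k oriented dimensions they cover H.  An oriented
-- dimension cannot separate a C–I pair in both copies, because every vertex of C(G₁) meets every
-- vertex of I(G₂) and vice versa; so one copy needs at most k of them, giving k threshold graphs.

indicator : {A : Set} → Dec A → ℚ
indicator a? = if does a? then 1ℚ else 0ℚ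

count : ∀ {n} {P : Pred (Fin n) 0ℓ} → Decidable P → ℚ
count {zero}  P? = 0ℚ
count {suc n} P? = indicator (P? zero) + count (P? ∘ suc)

indicator-nonneg : {A : Set} (a? : Dec A) → 0ℚ ≤ indicator a?
indicator-nonneg (yes _) = <⇒≤ (positive⁻¹ 1ℚ)
indicator-nonneg (no _)  = ≤-refl

indicator-pos : {A : Set} (a? : Dec A) → A → 0ℚ < indicator a?
indicator-pos (yes _) _ = positive⁻¹ 1ℚ
indicator-pos (no ¬a) a = contradiction a ¬a

indicator-mono-≤ : {A B : Set} (a? : Dec A) (b? : Dec B) → (A → B) → indicator a? ≤ indicator b?
indicator-mono-≤ (yes a) (no ¬b) a⇒b = contradiction (a⇒b a) ¬b
indicator-mono-≤ (yes _) (yes _) _   = ≤-refl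
indicator-mono-≤ (no _)  b?      _   = indicator-nonneg b?

indicator-mono-< : {A B : Set} (a? : Dec A) (b? : Dec B) → ¬ A → B → indicator a? < indicator b?
indicator-mono-< (yes a) _  ¬a _ = contradiction a ¬a
indicator-mono-< (no _)  b? _  b = indicator-pos b? b

count-nonneg : ∀ {n} {P : Pred (Fin n) 0ℓ} (P? : Decidable P) → 0ℚ ≤ count P?
count-nonneg {zero}  P? = ≤-refl
count-nonneg {suc n} P? = +-mono-≤ (indicator-nonneg (P? zero)) (count-nonneg (P? ∘ suc))

count-pos : ∀ {n} {P : Pred (Fin n) 0ℓ} (P? : Decidable P) (x : Fin n) → P x → 0ℚ < count P?
count-pos P? zero    px = +-mono-<-≤ (indicator-pos (P? zero) px) (count-nonneg (P? ∘ suc))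
count-pos P? (suc x) px = +-mono-≤-< (indicator-nonneg (P? zero)) (count-pos (P? ∘ suc) x px)

count-mono-≤ : ∀ {n} {P Q : Pred (Fin n) 0ℓ} (P? : Decidable P) (Q? : Decidable Q) →
               (∀ {x} → P x → Q x) → count P? ≤ count Q?
count-mono-≤ {zero}  P? Q? P⊆Q = ≤-refl
count-mono-≤ {suc n} P? Q? P⊆Q =
  +-mono-≤ (indicator-mono-≤ (P? zero) (Q? zero) P⊆Q) (count-mono-≤ (P? ∘ suc) (Q? ∘ suc) P⊆Q)

count-mono-< : ∀ {n} {P Q : Pred (Fin n) 0ℓ} (P? : Decidable P) (Q? : Decidable Q) →
               (∀ {x} → P x → Q x) → (x : Fin n) → ¬ P x → Q x → count P? < count Q?
count-mono-< P? Q? P⊆Q zero    ¬px qx =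
  +-mono-<-≤ (indicator-mono-< (P? zero) (Q? zero) ¬px qx) (count-mono-≤ (P? ∘ suc) (Q? ∘ suc) P⊆Q)
count-mono-< P? Q? P⊆Q (suc x) ¬px qx =
  +-mono-≤-< (indicator-mono-≤ (P? zero) (Q? zero) P⊆Q) (count-mono-< (P? ∘ suc) (Q? ∘ suc) P⊆Q x ¬px qx)

0≤-p+q⇔p≤q : ∀ p q → 0ℚ ≤ - p + q ⇔ p ≤ q
0≤-p+q⇔p≤q p q = mk⇔ from-diff to-diff
  where
  open ≤-Reasoning
  from-diff : 0ℚ ≤ - p + q → p ≤ q
  from-diff 0≤d = begin
    p               ≡⟨ sym (+-identityʳ p) ⟩
    p + 0ℚ          ≤⟨ +-monoʳ-≤ p 0≤d ⟩
    p + (- p + q)   ≡⟨ sym (+-assoc p (- p) q) ⟩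
    (p + - p) + q   ≡⟨ cong (_+ q) (+-inverseʳ p) ⟩
    0ℚ + q          ≡⟨ +-identityˡ q ⟩
    q               ∎
  to-diff : p ≤ q → 0ℚ ≤ - p + q
  to-diff p≤q = begin
    0ℚ      ≡⟨ sym (+-inverseˡ p) ⟩
    - p + p ≤⟨ +-monoʳ-≤ (- p) p≤q ⟩
    - p + q ∎

does≡true⇔ : {A : Set} (a? : Dec A) → does a? ≡ true ⇔ A
does≡true⇔ (yes a) = mk⇔ (const a) (const refl)
does≡true⇔ (no ¬a) = mk⇔ (λ ()) (λ a → contradiction a ¬a)

thresholdGraph : ∀ {n} → ℚ → (Fin n → ℚ) → Graph (Fin n)
thresholdGraph S w u v = not (does (u ≟ v)) ∧ does (S ≤? w u + w v)

module _ {n} (S : ℚ) (w : Fin n → ℚ) where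
  thresholdGraph-edge : ∀ {u v} → u ≢ v → thresholdGraph S w u v ≡ true ⇔ S ≤ w u + w v
  thresholdGraph-edge {u} {v} u≢v with u ≟ v
  ... | yes u≡v = contradiction u≡v u≢v
  ... | no _     = does≡true⇔ (S ≤? w u + w v)

  thresholdGraph-isSimple : IsSimple (thresholdGraph S w)
  thresholdGraph-isSimple = symmetric , irreflexive
    where
    symmetric : ∀ u v → thresholdGraph S w u v ≡ thresholdGraph S w v u
    symmetric u v with u ≟ v | v ≟ u
    ... | yes _   | yes _   = refl
    ... | yes u≡v | no v≢u  = contradiction (sym u≡v) v≢u
    ... | no u≢v  | yes v≡u = contradiction (sym v≡u) u≢v
    ... | no _    | no _    rewrite +-comm (w u) (w v) = refl
    irreflexive : ∀ v → thresholdGraph S w v v ≡ false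
    irreflexive v with v ≟ v
    ... | yes _   = refl
    ... | no v≢v  = contradiction refl v≢v

  thresholdGraph-isThreshold : IsThreshold (thresholdGraph S w)
  thresholdGraph-isThreshold = S , w , λ u v → thresholdGraph-edge

module SplitThreshold {n} (c : Fin n → Bool) (lo hi : Fin n → ℚ) where
  cliqueNotLeftOf? : (u : Fin n) → Decidable (λ y → c y ≡ true × lo u ≤ lo y)
  cliqueNotLeftOf? u y = (c y ≟ᵇ true) ×-dec (lo u ≤? lo y)

  cliqueRightOf? : (v : Fin n) → Decidable (λ y → c y ≡ true × hi v < lo y)
  cliqueRightOf? v y = (c y ≟ᵇ true) ×-dec (hi v <? lo y)

  cliqueNotLeftOf cliqueRightOf : Fin n → ℚ
  cliqueNotLeftOf u = count (cliqueNotLeftOf? u)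
  cliqueRightOf v = count (cliqueRightOf? v)

  -- Opaque, so that case splits on c u in clients do not rewrite inside the weights.
  opaque
    weight : Fin n → ℚ
    weight x = if c x then - cliqueNotLeftOf x else cliqueRightOf x

  cliqueNotLeftOf-pos : ∀ {u} → c u ≡ true → 0ℚ < cliqueNotLeftOf u
  cliqueNotLeftOf-pos {u} cu = count-pos (cliqueNotLeftOf? u) u (cu , ≤-refl)

  -- If lo u ≤ hi v, then u is counted by cliqueNotLeftOf u but not by cliqueRightOf v.
  cliqueNotLeftOf≤cliqueRightOf⇔ : ∀ {u v} → c u ≡ true → cliqueNotLeftOf u ≤ cliqueRightOf v ⇔ hi v < lo u
  cliqueNotLeftOf≤cliqueRightOf⇔ {u} {v} cu = mk⇔ to from
    where
    to : cliqueNotLeftOf u ≤ cliqueRightOf v → hi v < lo u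
    to A≤B with hi v <? lo u
    ... | yes v<u = v<u
    ... | no v≮u  = contradiction A≤B (λ A≤B → <-irrefl refl (<-≤-trans B<A A≤B))
      where
      B<A : cliqueRightOf v < cliqueNotLeftOf u
      B<A = count-mono-< (cliqueRightOf? v) (cliqueNotLeftOf? u)
                         (λ (cy , v<y) → cy , <⇒≤ (≤-<-trans (≮⇒≥ v≮u) v<y))
                         u (λ (_ , v<u) → v≮u v<u) (cu , ≤-refl)
    from : hi v < lo u → cliqueNotLeftOf u ≤ cliqueRightOf v
    from v<u = count-mono-≤ (cliqueNotLeftOf? u) (cliqueRightOf? v) (λ (cy , u≤y) → cy , <-≤-trans v<u u≤y)

  opaque
    unfolding weight

    weight-C-C : ∀ {u v} → c u ≡ true → c v ≡ true → weight u + weight v < 0ℚ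
    weight-C-C {u} {v} cu cv rewrite cu | cv =
      +-mono-< (neg-antimono-< (cliqueNotLeftOf-pos cu)) (neg-antimono-< (cliqueNotLeftOf-pos cv))

    weight-I-I : ∀ {u v} → c u ≡ false → c v ≡ false → 0ℚ ≤ weight u + weight v
    weight-I-I {u} {v} cu cv rewrite cu | cv =
      +-mono-≤ (count-nonneg (cliqueRightOf? u)) (count-nonneg (cliqueRightOf? v))

    weight-C-I : ∀ {u v} → c u ≡ true → c v ≡ false → 0ℚ ≤ weight u + weight v ⇔ hi v < lo u
    weight-C-I {u} {v} cu cv rewrite cu | cv =
      ⇔.trans (0≤-p+q⇔p≤q (cliqueNotLeftOf u) (cliqueRightOf v)) (cliqueNotLeftOf≤cliqueRightOf⇔ cu)

-- Orientation false reads the line backwards, so lo/hi are the ends of the mirrored interval.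
module Orientation {V : Set} (l r : V → ℚ) where
  lo hi : Bool → V → ℚ
  lo true  = l
  lo false = -_ ∘ r
  hi true  = r
  hi false = -_ ∘ l

  Meet : V → V → Set
  Meet X Y = l X ≤ r Y × l Y ≤ r X

  meet⇒lo≤hi : ∀ {X Y} → Meet X Y → ∀ s → lo s X ≤ hi s Y
  meet⇒lo≤hi (lX≤rY , _) true  = lX≤rY
  meet⇒lo≤hi (_ , lY≤rX) false = neg-antimono-≤ lY≤rX

  ¬meet⇒separated : ∀ {X Y} → ¬ Meet X Y → ∃[ s ] hi s Y < lo s X
  ¬meet⇒separated {X} {Y} ¬meet with l X ≤? r Y | l Y ≤? r X
  ... | no lX≰rY  | _         = true , ≰⇒> lX≰rY
  ... | yes lX≤rY | yes lY≤rX = contradiction (lX≤rY , lY≤rX) ¬meet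
  ... | yes _     | no lY≰rX  = false , neg-antimono-< (≰⇒> lY≰rX)

Enumerable : {A : Set} → ℕ → Pred A 0ℓ → Set
Enumerable {A} k P = Σ (Fin k → A) λ F → ∀ {x} → P x → ∃[ m ] F m ≡ x

list-enumerable : {A : Set} {k : ℕ} (ys : List A) → length ys ℕ.≤ k → (Fin k → A) → Enumerable k (_∈ ys)
list-enumerable []       _              F = F , λ ()
list-enumerable (y ∷ ys) (s≤s |ys|≤k) F with list-enumerable ys |ys|≤k (F ∘ suc)
... | G , G-onto = F′ , F′-onto
  where
  F′ : Fin _ → _
  F′ zero    = y
  F′ (suc m) = G m
  F′-onto : ∀ {x} → x ∈ y ∷ ys → ∃[ m ] F′ m ≡ x
  F′-onto (here refl)  = zero , refl
  F′-onto (there x∈ys) = let m , Gm≡x = G-onto x∈ys in suc m , Gm≡x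

length-filter-disjoint : {A : Set} {P Q : Pred A 0ℓ} (P? : Decidable P) (Q? : Decidable Q) →
                         (∀ {x} → P x → ¬ Q x) →
                         ∀ xs → length (filter P? xs) ℕ.+ length (filter Q? xs) ℕ.≤ length xs
length-filter-disjoint P? Q? disjoint []       = z≤n
length-filter-disjoint P? Q? disjoint (x ∷ xs) with P? x | Q? x | length-filter-disjoint P? Q? disjoint xs
... | yes px | yes qx | _  = contradiction qx (disjoint px)
... | yes _  | no _   | ih = s≤s ih
... | no _   | yes _  | ih = subst (ℕ._≤ suc (length xs)) (sym (ℕ.+-suc _ _)) (s≤s ih)
... | no _   | no _   | ih = ℕ.m≤n⇒m≤1+n ih

m+n≤o+o⇒m≤o⊎n≤o : ∀ {m n o} → m ℕ.+ n ℕ.≤ o ℕ.+ o → m ℕ.≤ o ⊎ n ℕ.≤ o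
m+n≤o+o⇒m≤o⊎n≤o {m} {n} {o} m+n≤o+o with m ℕ.≤? o | n ℕ.≤? o
... | yes m≤o | _       = inj₁ m≤o
... | no _    | yes n≤o = inj₂ n≤o
... | no m≰o  | no n≰o  = contradiction m+n≤o+o (ℕ.<⇒≱ (ℕ.+-mono-< (ℕ.≰⇒> m≰o) (ℕ.≰⇒> n≰o)))

slots : ∀ k → List (Fin k × Bool)
slots k = tabulate (_, true) ++ tabulate (_, false)

∈-slots : ∀ {k} (σ : Fin k × Bool) → σ ∈ slots k
∈-slots (i , true)  = ∈-++⁺ˡ (∈-tabulate⁺ i)
∈-slots (i , false) = ∈-++⁺ʳ _ (∈-tabulate⁺ i)

length-slots : ∀ k → length (slots k) ≡ k ℕ.+ k
length-slots k = trans (length-++ (tabulate {n = k} (_, true)))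
                       (cong₂ ℕ._+_ (length-tabulate {n = k} (_, true)) (length-tabulate {n = k} (_, false)))

disjoint-slots-enumerable : ∀ {k} {P Q : Pred (Fin k × Bool) 0ℓ} (P? : Decidable P) (Q? : Decidable Q) →
                            (∀ {σ} → P σ → ¬ Q σ) → Enumerable k P ⊎ Enumerable k Q
disjoint-slots-enumerable {k} P? Q? disjoint =
  Sum.map (enumerate P?) (enumerate Q?) (m+n≤o+o⇒m≤o⊎n≤o
    (ℕ.≤-trans (length-filter-disjoint P? Q? disjoint (slots k)) (ℕ.≤-reflexive (length-slots k))))
  where
  enumerate : ∀ {R} (R? : Decidable R) → length (filter R? (slots k)) ℕ.≤ k → Enumerable k R
  enumerate R? |R|≤k with list-enumerable (filter R? (slots k)) |R|≤k (_, true)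
  ... | F , F-onto = F , λ Rσ → F-onto (∈-filter⁺ R? (∈-slots _) Rσ)

complement-≢ : ∀ {n} (H : Graph (Fin n)) {u v} → u ≢ v → complement H u v ≡ not (H u v)
complement-≢ H {u} {v} u≢v with u ≟ v
... | yes u≡v = contradiction u≡v u≢v
... | no _    = refl

adjacent⇔complement-nonadjacent : ∀ {n} (H : Graph (Fin n)) {u v} → u ≢ v →
                                  H u v ≡ true ⇔ complement H u v ≡ false
adjacent⇔complement-nonadjacent H {u} {v} u≢v rewrite complement-≢ H u≢v with H u v
... | true  = mk⇔ (const refl) (const refl)
... | false = mk⇔ (λ ()) (λ ())

copy : ∀ {n} → Bool → Fin n → Fin n ⊎ Fin n
copy true  = inj₁
copy false = inj₂

copy-≢ : ∀ {n} j {u v : Fin n} → u ≢ v → copy j u ≢ copy j v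
copy-≢ true  u≢v refl = u≢v refl
copy-≢ false u≢v refl = u≢v refl

module _ {n} (G : Graph (Fin n)) (c : Fin n → Bool) where
  doubled-copy : ∀ j u v → doubled G c (copy j u) (copy j v) ≡ G u v
  doubled-copy true  u v = refl
  doubled-copy false u v = refl

  doubled-C₁-I₂ : ∀ {u v} → c u ≡ true → c v ≡ false → doubled G c (inj₁ u) (inj₂ v) ≡ true
  doubled-C₁-I₂ cu cv rewrite cu | cv = refl

  doubled-C₂-I₁ : ∀ {u v} → c u ≡ true → c v ≡ false → doubled G c (inj₂ u) (inj₁ v) ≡ true
  doubled-C₂-I₁ cu cv rewrite cu | cv = refl

  doubled-I-twins : ∀ {u} → c u ≡ false → doubled G c (inj₁ u) (inj₂ u) ≡ false
  doubled-I-twins cu rewrite cu = refl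

module BoxesToThresholds {n} (H : Graph (Fin n)) (H-sym : ∀ u v → H u v ≡ H v u) (c : Fin n → Bool)
       (c-split : IsSplitPartition (complement H) c) {k} (box : BoxRep k (doubled (complement H) c)) where
  G′ : Graph (Fin n ⊎ Fin n)
  G′ = doubled (complement H) c

  private
    interval : ∀ i → IsInterval (proj₁ box i)
    interval i = proj₁ (proj₂ (proj₂ box)) i

    module Dim (i : Fin k) = Orientation (proj₁ (interval i)) (proj₁ (proj₂ (interval i)))

    edge⇔meet : ∀ i {X Y} → X ≢ Y → proj₁ box i X Y ≡ true ⇔ Dim.Meet i X Y
    edge⇔meet i {X} {Y} = proj₂ (proj₂ (proj₂ (interval i))) X Y

    edge⇔all : ∀ {X Y} → X ≢ Y → G′ X Y ≡ true ⇔ (∀ i → proj₁ box i X Y ≡ true)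
    edge⇔all {X} {Y} = proj₂ (proj₂ (proj₂ box)) X Y

  Slot : Set
  Slot = Fin k × Bool

  lo hi : Slot → Fin n ⊎ Fin n → ℚ
  lo (i , s) = Dim.lo i s
  hi (i , s) = Dim.hi i s

  adjacent⇒lo≤hi : ∀ {X Y} → X ≢ Y → G′ X Y ≡ true → ∀ σ → lo σ X ≤ hi σ Y
  adjacent⇒lo≤hi X≢Y XY (i , s) =
    Dim.meet⇒lo≤hi i (Equivalence.to (edge⇔meet i X≢Y) (Equivalence.to (edge⇔all X≢Y) XY i)) s

  separated⇒nonadjacent : ∀ {X Y} σ → X ≢ Y → hi σ Y < lo σ X → G′ X Y ≡ false
  separated⇒nonadjacent {X} {Y} σ X≢Y Y<X with G′ X Y in XY
  ... | true  = contradiction (adjacent⇒lo≤hi X≢Y XY σ) (λ X≤Y → <-irrefl refl (<-≤-trans Y<X X≤Y))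
  ... | false = refl

  nonadjacent⇒separated : ∀ {X Y} → X ≢ Y → G′ X Y ≡ false → ∃[ σ ] hi σ Y < lo σ X
  nonadjacent⇒separated {X} {Y} X≢Y ¬XY =
    let i , ¬edge = ¬∀⟶∃¬ k _ (λ i → proj₁ box i X Y ≟ᵇ true) not-all
        s , Y<X   = Dim.¬meet⇒separated i (¬edge ∘ Equivalence.from (edge⇔meet i X≢Y))
    in (i , s) , Y<X
    where
    not-all : ¬ (∀ i → proj₁ box i X Y ≡ true)
    not-all all with () ← trans (sym ¬XY) (Equivalence.from (edge⇔all X≢Y) all)

  module Slice (j : Bool) (σ : Slot) = SplitThreshold c (lo σ ∘ copy j) (hi σ ∘ copy j)

  slotGraph : Bool → Slot → Graph (Fin n)
  slotGraph j σ = thresholdGraph 0ℚ (Slice.weight j σ)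

  slotGraph-edge : ∀ j σ {u v} → u ≢ v →
                   slotGraph j σ u v ≡ true ⇔ 0ℚ ≤ Slice.weight j σ u + Slice.weight j σ v
  slotGraph-edge j σ = thresholdGraph-edge 0ℚ (Slice.weight j σ)

  slotGraph-sym : ∀ j σ u v → slotGraph j σ u v ≡ slotGraph j σ v u
  slotGraph-sym j σ = proj₁ (thresholdGraph-isSimple 0ℚ (Slice.weight j σ))

  separated⇒H-adjacent : ∀ j σ {u v} → u ≢ v → hi σ (copy j v) < lo σ (copy j u) → H u v ≡ true
  separated⇒H-adjacent j σ {u} {v} u≢v v<u = Equivalence.from (adjacent⇔complement-nonadjacent H u≢v)
    (trans (sym (doubled-copy (complement H) c j u v)) (separated⇒nonadjacent σ (copy-≢ j u≢v) v<u))

  nonneg-weight⇒H-adjacent : ∀ j σ {u v} → u ≢ v → 0ℚ ≤ Slice.weight j σ u + Slice.weight j σ v →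
                             H u v ≡ true
  nonneg-weight⇒H-adjacent j σ {u} {v} u≢v 0≤w with c u in cu | c v in cv
  ... | true  | true  = contradiction (<-irrefl refl (≤-<-trans 0≤w (Slice.weight-C-C j σ cu cv))) λ ()
  ... | false | false = Equivalence.from (adjacent⇔complement-nonadjacent H u≢v) (proj₂ c-split u v cu cv)
  ... | true  | false = separated⇒H-adjacent j σ u≢v (Equivalence.to (Slice.weight-C-I j σ cu cv) 0≤w)
  ... | false | true  = trans (H-sym u v) (separated⇒H-adjacent j σ (u≢v ∘ sym)
          (Equivalence.to (Slice.weight-C-I j σ cv cu) (subst (0ℚ ≤_) (+-comm (Slice.weight j σ u) _) 0≤w)))

  slotGraph⊆H : ∀ j σ {u v} → u ≢ v → slotGraph j σ u v ≡ true → H u v ≡ true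
  slotGraph⊆H j σ u≢v uv = nonneg-weight⇒H-adjacent j σ u≢v (Equivalence.to (slotGraph-edge j σ u≢v) uv)

  Owns : Bool → Pred Slot 0ℓ
  Owns j σ = ∃[ u ] ∃[ v ] c u ≡ true × c v ≡ false × hi σ (copy j v) < lo σ (copy j u)

  owns? : ∀ j → Decidable (Owns j)
  owns? j σ = any? λ u → any? λ v →
    (c u ≟ᵇ true) ×-dec (c v ≟ᵇ false) ×-dec (hi σ (copy j v) <? lo σ (copy j u))

  owns-disjoint : ∀ {σ} → Owns true σ → ¬ Owns false σ
  owns-disjoint {σ} (u , v , cu , cv , v₁<u₁) (u′ , v′ , cu′ , cv′ , v′₂<u′₂) = <-irrefl refl (begin-strict
    lo σ (inj₁ u)  ≤⟨ adjacent⇒lo≤hi (λ ()) (doubled-C₁-I₂ (complement H) c cu cv′) σ ⟩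
    hi σ (inj₂ v′) <⟨ v′₂<u′₂ ⟩
    lo σ (inj₂ u′) ≤⟨ adjacent⇒lo≤hi (λ ()) (doubled-C₂-I₁ (complement H) c cu′ cv) σ ⟩
    hi σ (inj₁ v)  <⟨ v₁<u₁ ⟩
    lo σ (inj₁ u)  ∎)
    where open ≤-Reasoning

  module _ (j : Bool) (F : Fin k → Slot) (F-onto : ∀ {σ} → Owns j σ → ∃[ m ] F m ≡ σ) where
    cover-C-I : ∀ {u v} → c u ≡ true → c v ≡ false → u ≢ v → H u v ≡ true →
                ∃[ m ] slotGraph j (F m) u v ≡ true
    cover-C-I {u} {v} cu cv u≢v uv
      with σ , v<u ← nonadjacent⇒separated (copy-≢ j u≢v)
             (trans (doubled-copy (complement H) c j u v)
                    (Equivalence.to (adjacent⇔complement-nonadjacent H u≢v) uv))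
      with m , Fm≡σ ← F-onto {σ} (u , v , cu , cv , v<u)
      = m , subst (λ τ → slotGraph j τ u v ≡ true) (sym Fm≡σ)
              (Equivalence.from (slotGraph-edge j σ u≢v) (Equivalence.from (Slice.weight-C-I j σ cu cv) v<u))

    cover : ∀ {u v} → u ≢ v → H u v ≡ true → ∃[ m ] slotGraph j (F m) u v ≡ true
    cover {u} {v} u≢v uv with c u in cu | c v in cv
    ... | true  | true  with () ← trans (sym (Equivalence.to (adjacent⇔complement-nonadjacent H u≢v) uv))
                                         (proj₁ c-split u v u≢v cu cv)
    ... | true  | false = cover-C-I cu cv u≢v uv
    ... | false | true  = let m , vu = cover-C-I cv cu (u≢v ∘ sym) (trans (H-sym v u) uv)
                          in m , trans (slotGraph-sym j (F m) u v) vu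
    -- Every slot graph contains uv; a slot exists because the two copies of u are nonadjacent in G′.
    ... | false | false =
      let (m , _) , _ = nonadjacent⇒separated {inj₁ u} {inj₂ u} (λ ()) (doubled-I-twins (complement H) c cu)
      in m , Equivalence.from (slotGraph-edge j (F m) u≢v) (Slice.weight-I-I j (F m) cu cv)

  thresholdCover : ∀ j → Enumerable k (Owns j) → ThresholdCover k H
  thresholdCover j (F , F-onto) =
    (λ m → slotGraph j (F m)) ,
    (λ m → thresholdGraph-isSimple 0ℚ (Slice.weight j (F m))) ,
    (λ m → thresholdGraph-isThreshold 0ℚ (Slice.weight j (F m))) ,
    λ u v u≢v → mk⇔ (cover j F F-onto u≢v) (λ (m , uv) → slotGraph⊆H j (F m) u≢v uv)

lemma11 : (n : ℕ) (H : Graph (Fin n)) → IsSimple H → IsSplit H → ¬ IsCompleteSplit H →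
    (c : Fin n → Bool) → IsSplitPartition (complement H) c →
    (k : ℕ) → BoxRep k (doubled (complement H) c) → ThresholdCover k H
lemma11 n H (H-sym , _) _ _ c c-split k box =
  [ thresholdCover true , thresholdCover false ]
    (disjoint-slots-enumerable (owns? true) (owns? false) (λ {σ} → owns-disjoint {σ}))
  where open BoxesToThresholds H H-sym c c-split box
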